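{- There is an absolute constant $c>0$ such that the following holds. Let $n$ be a power of $2$, let $1\le d\le n$ and $\epsilon=d/n$. Then $$D^{lin,U}_{\frac{1-\sqrt\epsilon}{2}}(\mathrm{Add}_n)\ge d\qquad\text{and}\qquad D^{\rightarrow,U}_{c(1-\epsilon)/n}(\mathrm{Add}_n^+)\ge d.$$
   Context: The addressing function $\mathrm{Add}_n\colon\{0,1\}^{\log_2 n+n}\to\{0,1\}$ is $\mathrm{Add}_n(x,y_1,\dots,y_n)=y_x$ for $x\in\{0,1\}^{\log_2 n}$ interpreted as an index in $[n]$ and $y_i\in\{0,1\}$; inputs are viewed as elements of $\mathbb F_2^{N}$, $N=\log_2n+n$. $F^+(u,v)=F(u+v)$. $D^{lin,U}_\delta(F)$ is the smallest $k$ such that there are fixed $\alpha_1,\dots,\alpha_k\in\mathbb F_2^N$ and a function $g$ on $\mathbb F_2^k$ with $\Pr_{u\sim U(\mathbb F_2^N)}[g(\alpha_1\cdot u,\dots,\alpha_k\cdot u)=F(u)]\ge1-\delta$. For a two-party function $G$ on $\mathbb F_2^N\times\mathbb F_2^N$, $D^{\rightarrow,U}_\delta(G)$ is the smallest $t$ such that there are $M\colon\mathbb F_2^N\to\{0,1\}^t$ and $h\colon\{0,1\}^t\times\mathbb F_2^N\to\{0,1\}$ with $\Pr_{u,v}[h(M(u),v)=G(u,v)]\ge1-\delta$ for independent uniform $u,v$; the constant $c$ represents the paper's $\Theta(\cdot)$. -}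

module Defs where

open import Data.Bool using (Bool; true; false; _xor_; _∧_; if_then_else_)
open import Data.Bool.Properties using () renaming (_≟_ to _≟ᵇ_)
open import Data.Nat using (ℕ; zero; suc; _+_; _*_; _^_)
open import Data.Fin using (Fin; combine)
import Data.Fin as F
open import Data.Vec using (Vec; []; _∷_; map; zipWith; foldr; take; drop; lookup)
open import Data.List using (List; []; _∷_; concatMap)
open import Data.Nat.ListAction using (sum)
import Data.List as L
open import Relation.Nullary using (does)

-- Vectors in 𝔽₂^N are modelled as Vec Bool N (false = 0, true = 1).
𝔽₂^ : ℕ → Set
𝔽₂^ N = Vec Bool N

allVecs : (N : ℕ) → List (𝔽₂^ N)
allVecs zero = [] ∷ []
allVecs (suc N) = concatMap (λ v → (false ∷ v) ∷ (true ∷ v) ∷ []) (allVecs N)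

_⊕_ : ∀ {N} → 𝔽₂^ N → 𝔽₂^ N → 𝔽₂^ N
u ⊕ v = zipWith _xor_ u v

_·_ : ∀ {N} → 𝔽₂^ N → 𝔽₂^ N → Bool
α · u = foldr _ _xor_ false (zipWith _∧_ α u)

-- Binary encoding of x ∈ {0,1}^m as an index in [2^m] (most significant bit first).
bitFin : Bool → Fin 2
bitFin false = F.zero
bitFin true  = F.suc F.zero

toIndex : ∀ {m} → Vec Bool m → Fin (2 ^ m)
toIndex [] = F.zero
toIndex (b ∷ bs) = combine (bitFin b) (toIndex bs)

-- The addressing function Add_n with n = 2^m, on 𝔽₂^(m + 2^m).
Add : (m : ℕ) → 𝔽₂^ (m + 2 ^ m) → Bool
Add m u = lookup (drop m u) (toIndex (take m u))

_⁺ : ∀ {N} → (𝔽₂^ N → Bool) → 𝔽₂^ N → 𝔽₂^ N → Bool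
(F ⁺) u v = F (u ⊕ v)

indicator : Bool → Bool → ℕ
indicator a b = if does (a ≟ᵇ b) then 1 else 0

-- Number of u ∈ 𝔽₂^N on which the linear sketch (α₁,…,α_k ; g) computes F.
linAgree : ∀ {N k} → (𝔽₂^ N → Bool) → Vec (𝔽₂^ N) k → (Vec Bool k → Bool) → ℕ
linAgree {N} F α g = sum (L.map (λ u → indicator (g (map (λ a → a · u) α)) (F u)) (allVecs N))

-- Number of pairs (u , v) on which the one-way protocol (M , h) computes G.
owAgree : ∀ {N t} → (𝔽₂^ N → 𝔽₂^ N → Bool) → (𝔽₂^ N → Vec Bool t) → (Vec Bool t → 𝔽₂^ N → Bool) → ℕ
owAgree {N} G M h =
  sum (L.map (λ u → sum (L.map (λ v → indicator (h (M u) v) (G u v)) (allVecs N))) (allVecs N))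

module Submission where

-- Write an input as x ++ y, with x the address and y the memory. A linear
-- sketch of x ++ y is sketch(x ++ 𝟎) ⊕ φ y for a linear φ : 𝔽₂^n → 𝔽₂^k. If some w ∈ ker φ
-- has wᵢ = 1, pairing y with y ⊕ w shows that any decoder is right on exactly half of the
-- inputs with address i. Every other coordinate is a function of φ y, so each fibre of φ is
-- constant on it; doubling a fibre once per such coordinate shows that there are at most k
-- of them. Hence the advantage 2 Pr − 1 is at most k / n, and (k / n)² < d / n.
--
-- Fix Alice's address a and Bob's memory w. As Bob's address b varies, the
-- target runs through all bits of y ⊕ w, so a memory y for which Bob never errs is recovered
-- from Alice's t-bit message: there are at most 2^t ≤ 2^n / 2 of them. Every other y costs at
-- least one error among the n values of b, so the error probability is at least 1 / (2n).

open import Defs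
open import Data.Bool using (Bool; true; false; _xor_; _∧_; not; if_then_else_)
import Data.Bool as B
import Data.Bool.Properties as BP
open import Data.Nat using (ℕ; zero; suc; _+_; _*_; _^_; _∸_; _≤_; _<_; z≤n; s≤s; NonZero)
open import Data.Nat.Properties hiding (_≟_)
open import Data.Nat.ListAction using (sum)
open import Data.Nat.ListAction.Properties using (sum-++)
open import Data.Nat.Tactic.RingSolver using (solve-∀)
open import Data.Fin using (Fin)
import Data.Fin as F
import Data.Fin.Properties as FP
open import Data.Vec using (Vec; []; _∷_; _++_; replicate; lookup; tabulate)
import Data.Vec as V
import Data.Vec.Properties as VP
open import Data.List using (List; []; _∷_; length; concatMap; filter)
import Data.List as L
import Data.List.Properties as LP
open import Data.List.Membership.Propositional using (_∈_)
open import Data.List.Relation.Unary.All as All using (All; []; _∷_)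
import Data.List.Relation.Unary.All.Properties as Allₚ
open import Data.List.Relation.Unary.Any using (here; there)
open import Data.List.Relation.Unary.AllPairs as AllPairs using ([]; _∷_)
import Data.List.Relation.Unary.AllPairs.Properties as AllPairsₚ
open import Data.List.Relation.Unary.Unique.Propositional using (Unique)
import Data.List.Relation.Unary.Unique.Propositional.Properties as Unique
open import Data.List.Relation.Binary.Disjoint.Propositional using (Disjoint)
open import Data.Product using (Σ; ∃; _×_; _,_; proj₁; proj₂)
open import Data.Sum using (_⊎_; inj₁; inj₂)
open import Data.Empty using (⊥; ⊥-elim)
open import Function using (_∘_)
open import Relation.Nullary using (¬_; Dec; yes; no; does; contradiction)
open import Relation.Nullary.Decidable
  using (¬?; _×-dec_; _⊎-dec_; map′; dec-true; dec-false; decidable-stable)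
open import Relation.Unary using (Decidable)
open import Relation.Binary.PropositionalEquality

private variable
  A B : Set

𝟙 : Bool → ℕ
𝟙 b = if b then 1 else 0

𝟙≤1 : ∀ b → 𝟙 b ≤ 1
𝟙≤1 true  = ≤-refl
𝟙≤1 false = z≤n

indicator≤1 : ∀ a b → indicator a b ≤ 1
indicator≤1 a b = 𝟙≤1 (does (a B.≟ b))

indicator-+-not : ∀ a b → indicator a b + indicator a (not b) ≡ 1
indicator-+-not false false = refl
indicator-+-not false true  = refl
indicator-+-not true  false = refl
indicator-+-not true  true  = refl

indicator-≢ : ∀ {a b} → a ≢ b → indicator a b ≡ 0
indicator-≢ {a} {b} a≢b = cong 𝟙 (dec-false (a B.≟ b) a≢b)

∑ : List A → (A → ℕ) → ℕ
∑ xs f = sum (L.map f xs)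

∑-cong : ∀ (xs : List A) {f g : A → ℕ} → (∀ x → f x ≡ g x) → ∑ xs f ≡ ∑ xs g
∑-cong []       f≗g = refl
∑-cong (x ∷ xs) f≗g = cong₂ _+_ (f≗g x) (∑-cong xs f≗g)

∑-mono-≤ : ∀ (xs : List A) {f g : A → ℕ} → (∀ x → f x ≤ g x) → ∑ xs f ≤ ∑ xs g
∑-mono-≤ []       f≤g = z≤n
∑-mono-≤ (x ∷ xs) f≤g = +-mono-≤ (f≤g x) (∑-mono-≤ xs f≤g)

∑-++ : ∀ (xs ys : List A) f → ∑ (xs L.++ ys) f ≡ ∑ xs f + ∑ ys f
∑-++ xs ys f = trans (cong sum (LP.map-++ f xs ys)) (sum-++ (L.map f xs) (L.map f ys))

∑-distrib-+ : ∀ (xs : List A) f g → ∑ xs (λ x → f x + g x) ≡ ∑ xs f + ∑ xs g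
∑-distrib-+ []       f g = refl
∑-distrib-+ (x ∷ xs) f g = begin
  f x + g x + ∑ xs (λ x → f x + g x) ≡⟨ cong (f x + g x +_) (∑-distrib-+ xs f g) ⟩
  f x + g x + (∑ xs f + ∑ xs g)      ≡⟨ +-interchange (f x) (g x) (∑ xs f) (∑ xs g) ⟩
  f x + ∑ xs f + (g x + ∑ xs g)      ∎
  where
  open ≡-Reasoning
  +-interchange : ∀ a b c d → a + b + (c + d) ≡ a + c + (b + d)
  +-interchange = solve-∀

∑-*ˡ : ∀ (xs : List A) c f → ∑ xs (λ x → c * f x) ≡ c * ∑ xs f
∑-*ˡ []       c f = sym (*-zeroʳ c)
∑-*ˡ (x ∷ xs) c f = trans (cong (c * f x +_) (∑-*ˡ xs c f)) (sym (*-distribˡ-+ c (f x) (∑ xs f)))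

∑-const : ∀ (xs : List A) c → ∑ xs (λ _ → c) ≡ length xs * c
∑-const []       c = refl
∑-const (x ∷ xs) c = cong (c +_) (∑-const xs c)

∑-map : (g : A → B) (xs : List A) (f : B → ℕ) → ∑ (L.map g xs) f ≡ ∑ xs (f ∘ g)
∑-map g xs f = cong sum (sym (LP.map-∘ {g = f} {f = g} xs))

∑-concatMap : (g : A → List B) (xs : List A) (f : B → ℕ) →
              ∑ (concatMap g xs) f ≡ ∑ xs (λ x → ∑ (g x) f)
∑-concatMap g []       f = refl
∑-concatMap g (x ∷ xs) f =
  trans (∑-++ (g x) (concatMap g xs) f) (cong (∑ (g x) f +_) (∑-concatMap g xs f))

∑-swap : (xs : List A) (ys : List B) (f : A → B → ℕ) →
         ∑ xs (λ x → ∑ ys (f x)) ≡ ∑ ys (λ y → ∑ xs (λ x → f x y))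
∑-swap []       ys f = sym (trans (∑-const ys 0) (*-zeroʳ (length ys)))
∑-swap (x ∷ xs) ys f =
  trans (cong (∑ ys (f x) +_) (∑-swap xs ys f)) (sym (∑-distrib-+ ys (f x) _))

∑-𝟙-does : ∀ {P : A → Set} (P? : Decidable P) xs →
           ∑ xs (λ x → 𝟙 (does (P? x))) ≡ length (filter P? xs)
∑-𝟙-does P? []       = refl
∑-𝟙-does P? (x ∷ xs) with does (P? x)
... | true  = cong suc (∑-𝟙-does P? xs)
... | false = ∑-𝟙-does P? xs

∑-+-const≤ : ∀ (xs : List A) {f : A → ℕ} {c r} → (∀ x → f x + c ≤ r) →
             ∑ xs f + length xs * c ≤ length xs * r
∑-+-const≤ xs {f} {c} {r} f+c≤r = begin
  ∑ xs f + length xs * c  ≡⟨ cong (∑ xs f +_) (∑-const xs c) ⟨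
  ∑ xs f + ∑ xs (λ _ → c) ≡⟨ ∑-distrib-+ xs f (λ _ → c) ⟨
  ∑ xs (λ x → f x + c)    ≤⟨ ∑-mono-≤ xs f+c≤r ⟩
  ∑ xs (λ _ → r)          ≡⟨ ∑-const xs r ⟩
  length xs * r           ∎
  where open ≤-Reasoning

-- The vector space 𝔽₂^N

𝟎 : ∀ {N} → 𝔽₂^ N
𝟎 = replicate _ false

_≟_ : ∀ {N} (u v : 𝔽₂^ N) → Dec (u ≡ v)
_≟_ = VP.≡-dec B._≟_

⊕-assoc : ∀ {N} (u v w : 𝔽₂^ N) → (u ⊕ v) ⊕ w ≡ u ⊕ (v ⊕ w)
⊕-assoc = VP.zipWith-assoc BP.xor-assoc

⊕-identityˡ : ∀ {N} (u : 𝔽₂^ N) → 𝟎 ⊕ u ≡ u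
⊕-identityˡ = VP.zipWith-identityˡ BP.xor-identityˡ

⊕-identityʳ : ∀ {N} (u : 𝔽₂^ N) → u ⊕ 𝟎 ≡ u
⊕-identityʳ = VP.zipWith-identityʳ BP.xor-identityʳ

⊕-self : ∀ {N} (u : 𝔽₂^ N) → u ⊕ u ≡ 𝟎
⊕-self []      = refl
⊕-self (b ∷ u) = cong₂ _∷_ (BP.xor-same b) (⊕-self u)

⊕-cancelˡ : ∀ {N} (u v : 𝔽₂^ N) → u ⊕ (u ⊕ v) ≡ v
⊕-cancelˡ u v = begin
  u ⊕ (u ⊕ v) ≡⟨ ⊕-assoc u u v ⟨
  (u ⊕ u) ⊕ v ≡⟨ cong (_⊕ v) (⊕-self u) ⟩
  𝟎 ⊕ v       ≡⟨ ⊕-identityˡ v ⟩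
  v           ∎
  where open ≡-Reasoning

⊕-cancelʳ : ∀ {N} (u v : 𝔽₂^ N) → (u ⊕ v) ⊕ v ≡ u
⊕-cancelʳ u v = begin
  (u ⊕ v) ⊕ v ≡⟨ ⊕-assoc u v v ⟩
  u ⊕ (v ⊕ v) ≡⟨ cong (u ⊕_) (⊕-self v) ⟩
  u ⊕ 𝟎       ≡⟨ ⊕-identityʳ u ⟩
  u           ∎
  where open ≡-Reasoning

⊕-injectiveʳ : ∀ {N} {u v : 𝔽₂^ N} (w : 𝔽₂^ N) → u ⊕ w ≡ v ⊕ w → u ≡ v
⊕-injectiveʳ {u = u} {v} w e = trans (sym (⊕-cancelʳ u w)) (trans (cong (_⊕ w) e) (⊕-cancelʳ v w))

⊕-++ : ∀ {m n} (x x' : 𝔽₂^ m) (y y' : 𝔽₂^ n) → (x ++ y) ⊕ (x' ++ y') ≡ (x ⊕ x') ++ (y ⊕ y')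
⊕-++ x x' y y' = VP.zipWith-++ _xor_ x y x' y'

lookup-⊕ : ∀ {N} (u v : 𝔽₂^ N) i → lookup (u ⊕ v) i ≡ lookup u i xor lookup v i
lookup-⊕ u v i = VP.lookup-zipWith _xor_ i u v

lookup-extensionality : ∀ {N} {u v : 𝔽₂^ N} → (∀ i → lookup u i ≡ lookup v i) → u ≡ v
lookup-extensionality {u = u} {v} u≗v =
  trans (sym (VP.tabulate∘lookup u)) (trans (VP.tabulate-cong u≗v) (VP.tabulate∘lookup v))

·-distrib-⊕ : ∀ {N} (α u v : 𝔽₂^ N) → α · (u ⊕ v) ≡ (α · u) xor (α · v)
·-distrib-⊕ []      []      []      = refl
·-distrib-⊕ (a ∷ α) (x ∷ u) (y ∷ v) = begin
  (a ∧ (x xor y)) xor (α · (u ⊕ v))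
    ≡⟨ cong₂ _xor_ (BP.∧-distribˡ-xor a x y) (·-distrib-⊕ α u v) ⟩
  ((a ∧ x) xor (a ∧ y)) xor ((α · u) xor (α · v))
    ≡⟨ xor-interchange (a ∧ x) (a ∧ y) (α · u) (α · v) ⟩
  ((a ∧ x) xor (α · u)) xor ((a ∧ y) xor (α · v))
    ∎
  where
  open ≡-Reasoning
  xor-interchange : ∀ p q r s → (p xor q) xor (r xor s) ≡ (p xor r) xor (q xor s)
  xor-interchange false q false s = refl
  xor-interchange false q true  s = sym (BP.not-distribʳ-xor q s)
  xor-interchange true  q false s = sym (BP.not-distribˡ-xor q s)
  xor-interchange true  q true  s = BP.xor-annihilates-not q s

sketch : ∀ {N k} → Vec (𝔽₂^ N) k → 𝔽₂^ N → 𝔽₂^ k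
sketch α u = V.map (_· u) α

sketch-⊕ : ∀ {N k} (α : Vec (𝔽₂^ N) k) (u v : 𝔽₂^ N) →
           sketch α (u ⊕ v) ≡ sketch α u ⊕ sketch α v
sketch-⊕ []      u v = refl
sketch-⊕ (a ∷ α) u v = cong₂ _∷_ (·-distrib-⊕ a u v) (sketch-⊕ α u v)

unit : ∀ {N} → Fin N → 𝔽₂^ N
unit i = tabulate (λ j → does (j F.≟ i))

lookup-⊕-unit : ∀ {N} (y : 𝔽₂^ N) i → lookup (y ⊕ unit i) i ≡ not (lookup y i)
lookup-⊕-unit y i = begin
  lookup (y ⊕ unit i) i            ≡⟨ lookup-⊕ y (unit i) i ⟩
  lookup y i xor lookup (unit i) i ≡⟨ cong (lookup y i xor_) (VP.lookup∘tabulate _ i) ⟩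
  lookup y i xor does (i F.≟ i)    ≡⟨ cong (lookup y i xor_) (dec-true (i F.≟ i) refl) ⟩
  lookup y i xor true              ≡⟨ BP.xor-comm (lookup y i) true ⟩
  not (lookup y i)                 ∎
  where open ≡-Reasoning

lookup-⊕-unit-≢ : ∀ {N} (y : 𝔽₂^ N) {i j} → j ≢ i → lookup (y ⊕ unit i) j ≡ lookup y j
lookup-⊕-unit-≢ y {i} {j} j≢i = begin
  lookup (y ⊕ unit i) j            ≡⟨ lookup-⊕ y (unit i) j ⟩
  lookup y j xor lookup (unit i) j ≡⟨ cong (lookup y j xor_) (VP.lookup∘tabulate _ j) ⟩
  lookup y j xor does (j F.≟ i)    ≡⟨ cong (lookup y j xor_) (dec-false (j F.≟ i) j≢i) ⟩
  lookup y j xor false             ≡⟨ BP.xor-identityʳ (lookup y j) ⟩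
  lookup y j                       ∎
  where open ≡-Reasoning

-- Sums and counts over 𝔽₂^N

extensions : ∀ {N} → 𝔽₂^ N → List (𝔽₂^ (suc N))
extensions v = (false ∷ v) ∷ (true ∷ v) ∷ []

length-allVecs : ∀ N → length (allVecs N) ≡ 2 ^ N
length-allVecs zero    = refl
length-allVecs (suc N) = begin
  length (concatMap extensions (allVecs N)) ≡⟨ length-concat-extensions (allVecs N) ⟩
  length (allVecs N) * 2                    ≡⟨ cong (_* 2) (length-allVecs N) ⟩
  2 ^ N * 2                                 ≡⟨ *-comm (2 ^ N) 2 ⟩
  2 ^ suc N                                 ∎
  where
  open ≡-Reasoning
  length-concat-extensions : ∀ vs → length (concatMap extensions vs) ≡ length vs * 2
  length-concat-extensions []       = refl
  length-concat-extensions (v ∷ vs) = cong (suc ∘ suc) (length-concat-extensions vs)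

allVecs-unique : ∀ N → Unique (allVecs N)
allVecs-unique zero    = [] ∷ []
allVecs-unique (suc N) = Unique.concat⁺
  (Allₚ.map⁺ (All.universal (λ _ → extensions-unique) (allVecs N)))
  (AllPairsₚ.map⁺ (AllPairs.map extensions-disjoint (allVecs-unique N)))
  where
  extensions-unique : ∀ {v : 𝔽₂^ N} → Unique (extensions v)
  extensions-unique = ((λ ()) ∷ []) ∷ [] ∷ []
  tail-∈-extensions : ∀ {u : 𝔽₂^ (suc N)} {v} → u ∈ extensions v → V.tail u ≡ v
  tail-∈-extensions (here refl)         = refl
  tail-∈-extensions (there (here refl)) = refl
  extensions-disjoint : ∀ {v v' : 𝔽₂^ N} → v ≢ v' → Disjoint (extensions v) (extensions v')
  extensions-disjoint v≢v' (u∈ , u∈') =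
    v≢v' (trans (sym (tail-∈-extensions u∈)) (tail-∈-extensions u∈'))

∑𝔽 : ∀ N → (𝔽₂^ N → ℕ) → ℕ
∑𝔽 N = ∑ (allVecs N)

∑𝔽-suc : ∀ N (f : 𝔽₂^ (suc N) → ℕ) → ∑𝔽 (suc N) f ≡ ∑𝔽 N (λ v → f (false ∷ v) + f (true ∷ v))
∑𝔽-suc N f = trans (∑-concatMap extensions (allVecs N) f)
                   (∑-cong (allVecs N) (λ v → cong (f (false ∷ v) +_) (+-identityʳ _)))

∑𝔽-const : ∀ N c → ∑𝔽 N (λ _ → c) ≡ 2 ^ N * c
∑𝔽-const N c = trans (∑-const (allVecs N) c) (cong (_* c) (length-allVecs N))

∑𝔽-≤1 : ∀ N {f : 𝔽₂^ N → ℕ} → (∀ v → f v ≤ 1) → ∑𝔽 N f ≤ 2 ^ N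
∑𝔽-≤1 N f≤1 = ≤-trans (∑-mono-≤ (allVecs N) f≤1) (≤-reflexive (trans (∑𝔽-const N 1) (*-identityʳ _)))

∑𝔽-bound : ∀ N {f : 𝔽₂^ N → ℕ} {c r} → (∀ v → f v + c ≤ r) → ∑𝔽 N f + 2 ^ N * c ≤ 2 ^ N * r
∑𝔽-bound N {c = c} {r} f+c≤r = subst₂ (λ a b → ∑𝔽 N _ + a * c ≤ b * r)
  (length-allVecs N) (length-allVecs N) (∑-+-const≤ (allVecs N) f+c≤r)

∑𝔽-++ : ∀ m n (f : 𝔽₂^ (m + n) → ℕ) → ∑𝔽 (m + n) f ≡ ∑𝔽 m (λ x → ∑𝔽 n (λ y → f (x ++ y)))
∑𝔽-++ zero    n f = sym (+-identityʳ _)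
∑𝔽-++ (suc m) n f = begin
  ∑𝔽 (suc m + n) f
    ≡⟨ ∑𝔽-suc (m + n) f ⟩
  ∑𝔽 (m + n) (λ v → f (false ∷ v) + f (true ∷ v))
    ≡⟨ ∑-distrib-+ (allVecs (m + n)) _ _ ⟩
  ∑𝔽 (m + n) (λ v → f (false ∷ v)) + ∑𝔽 (m + n) (λ v → f (true ∷ v))
    ≡⟨ cong₂ _+_ (∑𝔽-++ m n _) (∑𝔽-++ m n _) ⟩
  ∑𝔽 m (λ x → ∑𝔽 n (λ y → f (false ∷ x ++ y))) + ∑𝔽 m (λ x → ∑𝔽 n (λ y → f (true ∷ x ++ y)))
    ≡⟨ ∑-distrib-+ (allVecs m) _ _ ⟨
  ∑𝔽 m (λ x → ∑𝔽 n (λ y → f (false ∷ x ++ y)) + ∑𝔽 n (λ y → f (true ∷ x ++ y)))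
    ≡⟨ ∑𝔽-suc m _ ⟨
  ∑𝔽 (suc m) (λ x → ∑𝔽 n (λ y → f (x ++ y)))
    ∎
  where open ≡-Reasoning

∑𝔽-translate : ∀ N (w : 𝔽₂^ N) (f : 𝔽₂^ N → ℕ) → ∑𝔽 N (λ z → f (z ⊕ w)) ≡ ∑𝔽 N f
∑𝔽-translate zero    []          f = refl
∑𝔽-translate (suc N) (false ∷ w) f = begin
  ∑𝔽 (suc N) (λ z → f (z ⊕ (false ∷ w)))            ≡⟨ ∑𝔽-suc N _ ⟩
  ∑𝔽 N (λ z → f (false ∷ z ⊕ w) + f (true ∷ z ⊕ w)) ≡⟨ ∑𝔽-translate N w _ ⟩
  ∑𝔽 N (λ z → f (false ∷ z) + f (true ∷ z))         ≡⟨ ∑𝔽-suc N f ⟨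
  ∑𝔽 (suc N) f                                      ∎
  where open ≡-Reasoning
∑𝔽-translate (suc N) (true ∷ w)  f = begin
  ∑𝔽 (suc N) (λ z → f (z ⊕ (true ∷ w)))             ≡⟨ ∑𝔽-suc N _ ⟩
  ∑𝔽 N (λ z → f (true ∷ z ⊕ w) + f (false ∷ z ⊕ w)) ≡⟨ ∑-cong (allVecs N) (λ z → +-comm (f (true ∷ z ⊕ w)) _) ⟩
  ∑𝔽 N (λ z → f (false ∷ z ⊕ w) + f (true ∷ z ⊕ w)) ≡⟨ ∑𝔽-translate N w _ ⟩
  ∑𝔽 N (λ z → f (false ∷ z) + f (true ∷ z))         ≡⟨ ∑𝔽-suc N f ⟨
  ∑𝔽 (suc N) f                                      ∎
  where open ≡-Reasoning

∑𝔽-point : ∀ N (u : 𝔽₂^ N) → ∑𝔽 N (λ v → 𝟙 (does (u ≟ v))) ≡ 1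
∑𝔽-point zero    []          = refl
∑𝔽-point (suc N) (false ∷ u) =
  trans (∑𝔽-suc N _) (trans (∑-cong (allVecs N) (λ v → +-identityʳ _)) (∑𝔽-point N u))
∑𝔽-point (suc N) (true ∷ u)  = trans (∑𝔽-suc N _) (∑𝔽-point N u)

∑𝔽-indicator+1≤ : ∀ {N} (f : 𝔽₂^ N → ℕ) → (∀ v → f v ≤ 1) → ∀ {v₀} → f v₀ ≡ 0 → ∑𝔽 N f + 1 ≤ 2 ^ N
∑𝔽-indicator+1≤ {N} f f≤1 {v₀} fv₀≡0 = begin
  ∑𝔽 N f + 1                              ≡⟨ cong (∑𝔽 N f +_) (∑𝔽-point N v₀) ⟨
  ∑𝔽 N f + ∑𝔽 N (λ v → 𝟙 (does (v₀ ≟ v))) ≡⟨ ∑-distrib-+ (allVecs N) f _ ⟨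
  ∑𝔽 N (λ v → f v + 𝟙 (does (v₀ ≟ v)))    ≤⟨ ∑𝔽-≤1 N pointwise ⟩
  2 ^ N                                   ∎
  where
  open ≤-Reasoning
  pointwise : ∀ v → f v + 𝟙 (does (v₀ ≟ v)) ≤ 1
  pointwise v with v₀ ≟ v
  ... | yes refl = ≤-reflexive (cong (_+ 1) fv₀≡0)
  ... | no _     = ≤-trans (≤-reflexive (+-identityʳ (f v))) (f≤1 v)

any𝔽? : ∀ N {P : 𝔽₂^ N → Set} → Decidable P → Dec (∃ P)
any𝔽? zero    P? = map′ ([] ,_) (λ { ([] , p) → p }) (P? [])
any𝔽? (suc N) P? =
  map′ extend restrict (any𝔽? N (P? ∘ (false ∷_)) ⊎-dec any𝔽? N (P? ∘ (true ∷_)))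
  where
  extend : _ ⊎ _ → ∃ _
  extend (inj₁ (v , p)) = false ∷ v , p
  extend (inj₂ (v , p)) = true ∷ v , p
  restrict : ∃ _ → _ ⊎ _
  restrict (false ∷ v , p) = inj₁ (v , p)
  restrict (true ∷ v , p)  = inj₂ (v , p)

#_ : ∀ {N} {P : 𝔽₂^ N → Set} → Decidable P → ℕ
#_ {N} P? = ∑𝔽 N (λ y → 𝟙 (does (P? y)))

#≤2^ : ∀ {N} {P : 𝔽₂^ N → Set} (P? : Decidable P) → # P? ≤ 2 ^ N
#≤2^ {N} P? = ∑𝔽-≤1 N (λ y → 𝟙≤1 (does (P? y)))

#-⊎ : ∀ {N} {P Q : 𝔽₂^ N → Set} (P? : Decidable P) (Q? : Decidable Q) → (∀ {y} → P y → Q y → ⊥) →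
      # (λ y → P? y ⊎-dec Q? y) ≡ # P? + # Q?
#-⊎ {N} P? Q? disjoint = trans (∑-cong (allVecs N) 𝟙-⊎) (∑-distrib-+ (allVecs N) _ _)
  where
  𝟙-⊎ : ∀ y → 𝟙 (does (P? y ⊎-dec Q? y)) ≡ 𝟙 (does (P? y)) + 𝟙 (does (Q? y))
  𝟙-⊎ y with P? y | Q? y
  ... | yes p | yes q = ⊥-elim (disjoint p q)
  ... | yes _ | no _  = refl
  ... | no _  | yes _ = refl
  ... | no _  | no _  = refl

#≤1 : ∀ {N} {P : 𝔽₂^ N → Set} (P? : Decidable P) → (∀ {y y'} → P y → P y' → y ≡ y') → # P? ≤ 1
#≤1 {N} P? unique with any𝔽? N P?
... | yes (y₀ , p₀) = ≤-trans (∑-mono-≤ (allVecs N) below-point) (≤-reflexive (∑𝔽-point N y₀))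
  where
  below-point : ∀ y → 𝟙 (does (P? y)) ≤ 𝟙 (does (y₀ ≟ y))
  below-point y with P? y
  ... | no _  = z≤n
  ... | yes p = ≤-reflexive (cong 𝟙 (sym (dec-true (y₀ ≟ y) (unique p₀ p))))
... | no none = ≤-trans (≤-reflexive (trans (∑-cong (allVecs N) empty) (trans (∑𝔽-const N 0) (*-zeroʳ (2 ^ N)))))
                        z≤n
  where
  empty : ∀ y → 𝟙 (does (P? y)) ≡ 0
  empty y with P? y
  ... | no _  = refl
  ... | yes p = contradiction (y , p) none

#≤2^-injective : ∀ {N t} {P : 𝔽₂^ N → Set} (P? : Decidable P) (f : 𝔽₂^ N → 𝔽₂^ t) →
                 (∀ {y y'} → P y → P y' → f y ≡ f y' → y ≡ y') → # P? ≤ 2 ^ t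
#≤2^-injective {N} {t} {P} P? f injective = begin
  # P?                                            ≡⟨ ∑-cong (allVecs N) 𝟙-as-∑ ⟩
  ∑𝔽 N (λ y → ∑𝔽 t (λ s → 𝟙 (does (fibre? s y)))) ≡⟨ ∑-swap (allVecs N) (allVecs t) _ ⟩
  ∑𝔽 t (λ s → # fibre? s)                         ≤⟨ ∑𝔽-≤1 t (λ s → #≤1 (fibre? s) fibre-unique) ⟩
  2 ^ t                                           ∎
  where
  open ≤-Reasoning
  fibre? : ∀ s y → Dec (P y × f y ≡ s)
  fibre? s y = P? y ×-dec (f y ≟ s)
  fibre-unique : ∀ {s y y'} → P y × f y ≡ s → P y' × f y' ≡ s → y ≡ y'
  fibre-unique (p , refl) (p' , e') = injective p p' (sym e')
  𝟙-as-∑ : ∀ y → 𝟙 (does (P? y)) ≡ ∑𝔽 t (λ s → 𝟙 (does (fibre? s y)))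
  𝟙-as-∑ y with P? y
  ... | yes _ = sym (∑𝔽-point t (f y))
  ... | no _  = sym (trans (∑𝔽-const t 0) (*-zeroʳ (2 ^ t)))

-- Coordinates determined by a map

ConstantOn : ∀ {n} → (𝔽₂^ n → Set) → Fin n → Set
ConstantOn S i = ∀ {y y'} → S y → S y' → lookup y i ≡ lookup y' i

-- Each coordinate i on which S is constant doubles S to the disjoint union S ∪ (S ⊕ eᵢ),
-- which is still constant on the other coordinates.
2^length*#≤2^ : ∀ {n} {S : 𝔽₂^ n → Set} (S? : Decidable S) (is : List (Fin n)) →
                Unique is → All (ConstantOn S) is → 2 ^ length is * # S? ≤ 2 ^ n
2^length*#≤2^ S? [] _ _ = ≤-trans (≤-reflexive (+-identityʳ _)) (#≤2^ S?)
2^length*#≤2^ {n} {S} S? (i ∷ is) (i∉is ∷ is-unique) (Sᵢ ∷ S-constant) = begin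
  2 ^ suc (length is) * # S?    ≡⟨ double (2 ^ length is) (# S?) ⟩
  2 ^ length is * (# S? + # S?) ≡⟨ cong (2 ^ length is *_) #S' ⟨
  2 ^ length is * # S'?         ≤⟨ 2^length*#≤2^ S'? is is-unique (All.zipWith S'-constant (i∉is , S-constant)) ⟩
  2 ^ n                         ∎
  where
  open ≤-Reasoning
  double : ∀ a c → 2 * a * c ≡ a * (c + c)
  double = solve-∀
  S' : 𝔽₂^ n → Set
  S' y = S y ⊎ S (y ⊕ unit i)
  S'? : Decidable S'
  S'? y = S? y ⊎-dec S? (y ⊕ unit i)
  disjoint : ∀ {y} → S y → S (y ⊕ unit i) → ⊥
  disjoint {y} p p' = BP.not-¬ refl (trans (Sᵢ p p') (lookup-⊕-unit y i))
  #S' : # S'? ≡ # S? + # S?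
  #S' = trans (#-⊎ S? (λ y → S? (y ⊕ unit i)) disjoint) (cong (# S? +_) (∑𝔽-translate n (unit i) _))
  representative : ∀ {y j} → i ≢ j → S' y → Σ (𝔽₂^ n) λ ŷ → S ŷ × lookup ŷ j ≡ lookup y j
  representative {y} i≢j (inj₁ p) = y , p , refl
  representative {y} i≢j (inj₂ p) = y ⊕ unit i , p , lookup-⊕-unit-≢ y (i≢j ∘ sym)
  S'-constant : ∀ {j} → i ≢ j × ConstantOn S j → ConstantOn S' j
  S'-constant (i≢j , Sⱼ) p p' with representative i≢j p | representative i≢j p'
  ... | _ , q , e | _ , q' , e' = trans (sym e) (trans (Sⱼ q q') e')

Determined : ∀ {n k} → (𝔽₂^ n → 𝔽₂^ k) → Fin n → Set
Determined φ i = ∀ {y y'} → φ y ≡ φ y' → lookup y i ≡ lookup y' i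

2^-cancel-≤ : ∀ {a b} → 2 ^ a ≤ 2 ^ b → a ≤ b
2^-cancel-≤ 2^a≤2^b = ≮⇒≥ (λ b<a → <⇒≱ (^-monoʳ-< 2 (s≤s (s≤s z≤n)) b<a) 2^a≤2^b)

length-determined≤ : ∀ {n k} (φ : 𝔽₂^ n → 𝔽₂^ k) (is : List (Fin n)) →
                     Unique is → All (Determined φ) is → length is ≤ k
length-determined≤ {n} {k} φ is is-unique determined =
  2^-cancel-≤ (*-cancelʳ-≤ (2 ^ length is) (2 ^ k) (2 ^ n) {{m^n≢0 2 n}} (begin
    2 ^ length is * 2 ^ n                   ≡⟨ cong (2 ^ length is *_) fibres-partition ⟨
    2 ^ length is * ∑𝔽 k (λ v → # fibre? v) ≡⟨ ∑-*ˡ (allVecs k) (2 ^ length is) _ ⟨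
    ∑𝔽 k (λ v → 2 ^ length is * # fibre? v) ≤⟨ ∑-mono-≤ (allVecs k) fibre-bound ⟩
    ∑𝔽 k (λ _ → 2 ^ n)                      ≡⟨ ∑𝔽-const k (2 ^ n) ⟩
    2 ^ k * 2 ^ n                           ∎))
  where
  open ≤-Reasoning
  fibre? : ∀ v y → Dec (φ y ≡ v)
  fibre? v y = φ y ≟ v
  fibre-bound : ∀ v → 2 ^ length is * # fibre? v ≤ 2 ^ n
  fibre-bound v = 2^length*#≤2^ (fibre? v) is is-unique (All.map fibre-constant determined)
    where
    fibre-constant : ∀ {j} → Determined φ j → ConstantOn (λ y → φ y ≡ v) j
    fibre-constant det e e' = det (trans e (sym e'))
  fibres-partition : ∑𝔽 k (λ v → # fibre? v) ≡ 2 ^ n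
  fibres-partition = begin-equality
    ∑𝔽 k (λ v → # fibre? v)                      ≡⟨ ∑-swap (allVecs k) (allVecs n) _ ⟩
    ∑𝔽 n (λ y → ∑𝔽 k (λ v → 𝟙 (does (φ y ≟ v)))) ≡⟨ ∑-cong (allVecs n) (λ y → ∑𝔽-point k (φ y)) ⟩
    ∑𝔽 n (λ _ → 1)                               ≡⟨ trans (∑𝔽-const n 1) (*-identityʳ _) ⟩
    2 ^ n                                        ∎

-- The addressing function

split-++ : ∀ {m n} (x : Vec A m) (y : Vec A n) → V.take m (x ++ y) ≡ x × V.drop m (x ++ y) ≡ y
split-++ {m = m} x y = VP.++-injective (V.take m (x ++ y)) x (VP.take++drop≡id m (x ++ y))

Add-++ : ∀ m (x : 𝔽₂^ m) (y : 𝔽₂^ (2 ^ m)) → Add m (x ++ y) ≡ lookup y (toIndex x)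
Add-++ m x y = cong₂ lookup (proj₂ (split-++ x y)) (cong toIndex (proj₁ (split-++ x y)))

bitFin-injective : ∀ {b b'} → bitFin b ≡ bitFin b' → b ≡ b'
bitFin-injective {false} {false} _ = refl
bitFin-injective {true}  {true}  _ = refl

bitFin-surjective : ∀ (j : Fin 2) → ∃ λ b → bitFin b ≡ j
bitFin-surjective F.zero         = false , refl
bitFin-surjective (F.suc F.zero) = true , refl

toIndex-injective : ∀ {m} {x x' : 𝔽₂^ m} → toIndex x ≡ toIndex x' → x ≡ x'
toIndex-injective {x = []}    {[]}      _ = refl
toIndex-injective {x = b ∷ x} {b' ∷ x'} e =
  let b≡b' , x≡x' = FP.combine-injective (bitFin b) (toIndex x) (bitFin b') (toIndex x') e
  in cong₂ _∷_ (bitFin-injective b≡b') (toIndex-injective x≡x')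

toIndex-surjective : ∀ {m} (i : Fin (2 ^ m)) → ∃ λ x → toIndex {m} x ≡ i
toIndex-surjective {zero}  F.zero = [] , refl
toIndex-surjective {suc m} i with FP.combine-surjective {2} {2 ^ m} i
... | j , l , refl with bitFin-surjective j | toIndex-surjective {m} l
...   | b , refl | x , refl = b ∷ x , refl

2^[m+2^m]≡ : ∀ m → 2 ^ (m + 2 ^ m) ≡ 2 ^ m * 2 ^ 2 ^ m
2^[m+2^m]≡ m = ^-distribˡ-+-* 2 m (2 ^ m)

-- Linear sketches of the addressing function

2*agreement≡2^ : ∀ {N} (f : 𝔽₂^ N → Bool) {i w} → lookup w i ≡ true → (∀ y → f (y ⊕ w) ≡ f y) →
                 2 * ∑𝔽 N (λ y → indicator (f y) (lookup y i)) ≡ 2 ^ N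
2*agreement≡2^ {N} f {i} {w} wᵢ≡1 f-invariant = begin
  2 * ∑𝔽 N agree                          ≡⟨ cong (∑𝔽 N agree +_) (+-identityʳ _) ⟩
  ∑𝔽 N agree + ∑𝔽 N agree                 ≡⟨ cong (∑𝔽 N agree +_) (∑𝔽-translate N w agree) ⟨
  ∑𝔽 N agree + ∑𝔽 N (λ y → agree (y ⊕ w)) ≡⟨ ∑-distrib-+ (allVecs N) agree (agree ∘ (_⊕ w)) ⟨
  ∑𝔽 N (λ y → agree y + agree (y ⊕ w))    ≡⟨ ∑-cong (allVecs N) paired ⟩
  ∑𝔽 N (λ _ → 1)                          ≡⟨ trans (∑𝔽-const N 1) (*-identityʳ _) ⟩
  2 ^ N                                   ∎
  where
  open ≡-Reasoning
  agree : 𝔽₂^ N → ℕ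
  agree y = indicator (f y) (lookup y i)
  paired : ∀ y → agree y + agree (y ⊕ w) ≡ 1
  paired y = begin
    agree y + indicator (f (y ⊕ w)) (lookup (y ⊕ w) i)
      ≡⟨ cong₂ (λ a b → agree y + indicator a b) (f-invariant y) (lookup-⊕ y w i) ⟩
    agree y + indicator (f y) (lookup y i xor lookup w i)
      ≡⟨ cong (λ b → agree y + indicator (f y) (lookup y i xor b)) wᵢ≡1 ⟩
    agree y + indicator (f y) (lookup y i xor true)
      ≡⟨ cong (λ b → agree y + indicator (f y) b) (BP.xor-comm (lookup y i) true) ⟩
    agree y + indicator (f y) (not (lookup y i))
      ≡⟨ indicator-+-not (f y) (lookup y i) ⟩
    1 ∎

xor≢true⇒≡ : ∀ {a b} → a xor b ≢ true → a ≡ b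
xor≢true⇒≡ {false} {false} _  = refl
xor≢true⇒≡ {false} {true}  ne = contradiction refl ne
xor≢true⇒≡ {true}  {false} ne = contradiction refl ne
xor≢true⇒≡ {true}  {true}  _  = refl

module LinearSketch (m : ℕ) {k : ℕ} (α : Vec (𝔽₂^ (m + 2 ^ m)) k) (g : Vec Bool k → Bool) where

  n = 2 ^ m

  φ : 𝔽₂^ n → 𝔽₂^ k
  φ y = sketch α (𝟎 ++ y)

  sketch-++-⊕ : ∀ x y w → sketch α (x ++ (y ⊕ w)) ≡ sketch α (x ++ y) ⊕ φ w
  sketch-++-⊕ x y w = begin
    sketch α (x ++ (y ⊕ w))        ≡⟨ cong (λ x' → sketch α (x' ++ (y ⊕ w))) (⊕-identityʳ x) ⟨
    sketch α ((x ⊕ 𝟎) ++ (y ⊕ w))  ≡⟨ cong (sketch α) (⊕-++ x 𝟎 y w) ⟨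
    sketch α ((x ++ y) ⊕ (𝟎 ++ w)) ≡⟨ sketch-⊕ α (x ++ y) (𝟎 ++ w) ⟩
    sketch α (x ++ y) ⊕ φ w        ∎
    where open ≡-Reasoning

  Free : Fin n → Set
  Free i = ∃ λ z → φ z ≡ 𝟎 × lookup z i ≡ true

  free? : Decidable Free
  free? i = any𝔽? n (λ z → (φ z ≟ 𝟎) ×-dec (lookup z i B.≟ true))

  ¬free⇒determined : ∀ {i} → ¬ Free i → Determined φ i
  ¬free⇒determined {i} not-free {y} {y'} φy≡φy' = xor≢true⇒≡ λ yᵢ+y'ᵢ≡1 →
    not-free (y ⊕ y' , φ-kernel , trans (lookup-⊕ y y' i) yᵢ+y'ᵢ≡1)
    where
    φ-kernel : φ (y ⊕ y') ≡ 𝟎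
    φ-kernel = trans (sketch-++-⊕ 𝟎 y y') (trans (cong (_⊕ φ y') φy≡φy') (⊕-self (φ y')))

  agreement : 𝔽₂^ m → ℕ
  agreement x = ∑𝔽 n (λ y → indicator (g (sketch α (x ++ y))) (lookup y (toIndex x)))

  determined : 𝔽₂^ m → ℕ
  determined x = 𝟙 (does (¬? (free? (toIndex x))))

  2*agreement≤ : ∀ x → 2 * agreement x ≤ 2 ^ n + 2 ^ n * determined x
  2*agreement≤ x with free? (toIndex x)
  ... | yes (w , φw≡𝟎 , wᵢ≡1) =
    ≤-trans (≤-reflexive (2*agreement≡2^ _ wᵢ≡1 invariant)) (m≤m+n (2 ^ n) _)
    where
    invariant : ∀ y → g (sketch α (x ++ (y ⊕ w))) ≡ g (sketch α (x ++ y))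
    invariant y = cong g (trans (sketch-++-⊕ x y w)
                                (trans (cong (sketch α (x ++ y) ⊕_) φw≡𝟎) (⊕-identityʳ _)))
  ... | no _ = ≤-trans (*-monoʳ-≤ 2 agreement≤2^) (≤-reflexive (cong (2 ^ n +_) 2^n+0≡2^n*1))
    where
    agreement≤2^ : agreement x ≤ 2 ^ n
    agreement≤2^ = ∑𝔽-≤1 n (λ y → indicator≤1 (g (sketch α (x ++ y))) (lookup y (toIndex x)))
    2^n+0≡2^n*1 : 2 ^ n + 0 ≡ 2 ^ n * 1
    2^n+0≡2^n*1 = trans (+-identityʳ _) (sym (*-identityʳ _))

  linAgree≡∑agreement : linAgree (Add m) α g ≡ ∑𝔽 m agreement
  linAgree≡∑agreement = trans (∑𝔽-++ m n _) (∑-cong (allVecs m) λ x → ∑-cong (allVecs n) λ y →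
    cong (indicator (g (sketch α (x ++ y)))) (Add-++ m x y))

  ∑determined≤k : ∑𝔽 m determined ≤ k
  ∑determined≤k = begin
    ∑𝔽 m determined                             ≡⟨ ∑-map toIndex (allVecs m) _ ⟨
    ∑ addresses (λ i → 𝟙 (does (¬? (free? i)))) ≡⟨ ∑-𝟙-does (¬? ∘ free?) addresses ⟩
    length (filter (¬? ∘ free?) addresses)      ≤⟨ length-determined≤ φ _ unique all-determined ⟩
    k                                           ∎
    where
    open ≤-Reasoning
    addresses = L.map toIndex (allVecs m)
    unique = Unique.filter⁺ (¬? ∘ free?) (Unique.map⁺ toIndex-injective (allVecs-unique m))
    all-determined = All.map ¬free⇒determined (Allₚ.all-filter (¬? ∘ free?) addresses)

  2*linAgree≤ : 2 * linAgree (Add m) α g ≤ 2 ^ m * 2 ^ n + 2 ^ n * k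
  2*linAgree≤ = begin
    2 * linAgree (Add m) α g                               ≡⟨ cong (2 *_) linAgree≡∑agreement ⟩
    2 * ∑𝔽 m agreement                                     ≡⟨ ∑-*ˡ (allVecs m) 2 agreement ⟨
    ∑𝔽 m (λ x → 2 * agreement x)                           ≤⟨ ∑-mono-≤ (allVecs m) 2*agreement≤ ⟩
    ∑𝔽 m (λ x → 2 ^ n + 2 ^ n * determined x)              ≡⟨ ∑-distrib-+ (allVecs m) _ _ ⟩
    ∑𝔽 m (λ _ → 2 ^ n) + ∑𝔽 m (λ x → 2 ^ n * determined x) ≡⟨ cong₂ _+_ (∑𝔽-const m (2 ^ n))
                                                                         (∑-*ˡ (allVecs m) (2 ^ n) _) ⟩
    2 ^ m * 2 ^ n + 2 ^ n * ∑𝔽 m determined                ≤⟨ +-monoʳ-≤ (2 ^ m * 2 ^ n)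
                                                                         (*-monoʳ-≤ (2 ^ n) ∑determined≤k) ⟩
    2 ^ m * 2 ^ n + 2 ^ n * k                              ∎
    where open ≤-Reasoning

sketch-arithmetic : ∀ {A k d n X} .{{_ : NonZero n}} .{{_ : NonZero X}} →
                    2 * A ≤ n * X + X * k → k < d → d ≤ n →
                    ¬ (d * ((n * X) * (n * X)) ≤ n * ((2 * A ∸ n * X) * (2 * A ∸ n * X)))
sketch-arithmetic {A} {k} {d} {n} {X} {{n≢0}} 2A≤ k<d d≤n big =
  <⇒≱ (*-mono-< k<d (<-≤-trans k<d d≤n)) dn≤kk
  where
  instance
    nXX≢0 : NonZero (n * (X * X))
    nXX≢0 = m*n≢0 n (X * X) {{n≢0}} {{m*n≢0 X X}}
  excess≤ : 2 * A ∸ n * X ≤ X * k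
  excess≤ = ≤-trans (∸-monoˡ-≤ (n * X) 2A≤) (≤-reflexive (m+n∸m≡n (n * X) (X * k)))
  regroup₁ : ∀ d n X → d * n * (n * (X * X)) ≡ d * ((n * X) * (n * X))
  regroup₁ = solve-∀
  regroup₂ : ∀ n X k → n * ((X * k) * (X * k)) ≡ k * k * (n * (X * X))
  regroup₂ = solve-∀
  dn≤kk : d * n ≤ k * k
  dn≤kk = *-cancelʳ-≤ (d * n) (k * k) (n * (X * X)) (begin
    d * n * (n * (X * X))                   ≡⟨ regroup₁ d n X ⟩
    d * ((n * X) * (n * X))                 ≤⟨ big ⟩
    n * ((2 * A ∸ n * X) * (2 * A ∸ n * X)) ≤⟨ *-monoʳ-≤ n (*-mono-≤ excess≤ excess≤) ⟩
    n * ((X * k) * (X * k))                 ≡⟨ regroup₂ n X k ⟩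
    k * k * (n * (X * X))                   ∎)
    where open ≤-Reasoning

linear-sketch-lower-bound : ∀ m d → d ≤ 2 ^ m → ∀ k → k < d →
  (α : Vec (𝔽₂^ (m + 2 ^ m)) k) (g : Vec Bool k → Bool) →
  ¬ (d * (2 ^ (m + 2 ^ m) * 2 ^ (m + 2 ^ m))
     ≤ 2 ^ m * ((2 * linAgree (Add m) α g ∸ 2 ^ (m + 2 ^ m)) * (2 * linAgree (Add m) α g ∸ 2 ^ (m + 2 ^ m))))
linear-sketch-lower-bound m d d≤n k k<d α g rewrite 2^[m+2^m]≡ m =
  sketch-arithmetic {A = linAgree (Add m) α g} {{m^n≢0 2 m}} {{m^n≢0 2 (2 ^ m)}}
    (LinearSketch.2*linAgree≤ m α g) k<d d≤n

-- One-way protocols for the addressing function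

-- Bob answers β s b to Alice's message s = μ y; the target is bit ρ b of τ y.
one-way-index-bound : ∀ {n m t p} (μ : 𝔽₂^ n → 𝔽₂^ t) (β : 𝔽₂^ t → 𝔽₂^ m → Bool)
  (τ : 𝔽₂^ n → 𝔽₂^ p) (ρ : 𝔽₂^ m → Fin p) → (∀ {y y'} → τ y ≡ τ y' → y ≡ y') → (∀ i → ∃ λ b → ρ b ≡ i) →
  ∑𝔽 n (λ y → ∑𝔽 m (λ b → indicator (β (μ y) b) (lookup (τ y) (ρ b)))) + 2 ^ n ≤ 2 ^ n * 2 ^ m + 2 ^ t
one-way-index-bound {n} {m} {t} μ β τ ρ τ-injective ρ-surjective = begin
  ∑𝔽 n agreement + 2 ^ n
    ≡⟨ cong (∑𝔽 n agreement +_) (trans (∑𝔽-const n 1) (*-identityʳ _)) ⟨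
  ∑𝔽 n agreement + ∑𝔽 n (λ _ → 1)
    ≡⟨ ∑-distrib-+ (allVecs n) agreement (λ _ → 1) ⟨
  ∑𝔽 n (λ y → agreement y + 1)
    ≤⟨ ∑-mono-≤ (allVecs n) agreement+1≤ ⟩
  ∑𝔽 n (λ y → 2 ^ m + 𝟙 (does (perfect? y)))
    ≡⟨ ∑-distrib-+ (allVecs n) _ _ ⟩
  ∑𝔽 n (λ _ → 2 ^ m) + # perfect?
    ≤⟨ +-mono-≤ (≤-reflexive (∑𝔽-const n (2 ^ m))) (#≤2^-injective perfect? μ perfect-injective) ⟩
  2 ^ n * 2 ^ m + 2 ^ t
    ∎
  where
  open ≤-Reasoning
  agree : 𝔽₂^ n → 𝔽₂^ m → ℕ
  agree y b = indicator (β (μ y) b) (lookup (τ y) (ρ b))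
  agree≤1 : ∀ y b → agree y b ≤ 1
  agree≤1 y b = indicator≤1 (β (μ y) b) (lookup (τ y) (ρ b))
  agreement : 𝔽₂^ n → ℕ
  agreement y = ∑𝔽 m (agree y)
  Correct : 𝔽₂^ n → 𝔽₂^ m → Set
  Correct y b = β (μ y) b ≡ lookup (τ y) (ρ b)
  Perfect : 𝔽₂^ n → Set
  Perfect y = ¬ ∃ λ b → ¬ Correct y b
  error? : ∀ y → Dec (∃ λ b → ¬ Correct y b)
  error? y = any𝔽? m (λ b → ¬? (β (μ y) b B.≟ lookup (τ y) (ρ b)))
  perfect? : Decidable Perfect
  perfect? y = ¬? (error? y)
  agreement+1≤ : ∀ y → agreement y + 1 ≤ 2 ^ m + 𝟙 (does (perfect? y))
  agreement+1≤ y with error? y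
  ... | yes (b , wrong) =
    ≤-trans (∑𝔽-indicator+1≤ (agree y) (agree≤1 y) (indicator-≢ wrong)) (m≤m+n (2 ^ m) 0)
  ... | no _            = +-monoˡ-≤ 1 (∑𝔽-≤1 m (agree≤1 y))
  correct : ∀ {y} → Perfect y → ∀ b → Correct y b
  correct {y} perfect b =
    decidable-stable (β (μ y) b B.≟ lookup (τ y) (ρ b)) (λ wrong → perfect (b , wrong))
  perfect-injective : ∀ {y y'} → Perfect y → Perfect y' → μ y ≡ μ y' → y ≡ y'
  perfect-injective {y} {y'} perfect perfect' μy≡μy' = τ-injective (lookup-extensionality same-bit)
    where
    same-bit : ∀ i → lookup (τ y) i ≡ lookup (τ y') i
    same-bit i with ρ-surjective i
    ... | b , refl = trans (sym (correct perfect b)) (trans (cong (λ s → β s b) μy≡μy') (correct perfect' b))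

module OneWay (m : ℕ) {t : ℕ} (M : 𝔽₂^ (m + 2 ^ m) → 𝔽₂^ t) (h : 𝔽₂^ t → 𝔽₂^ (m + 2 ^ m) → Bool) where

  n = 2 ^ m

  -- Alice holds a ++ y and Bob b ++ w; the target is bit toIndex (a ⊕ b) of y ⊕ w.
  agree : 𝔽₂^ m → 𝔽₂^ n → 𝔽₂^ m → 𝔽₂^ n → ℕ
  agree a y b w = indicator (h (M (a ++ y)) (b ++ w)) (lookup (y ⊕ w) (toIndex (a ⊕ b)))

  agreement : 𝔽₂^ m → 𝔽₂^ n → ℕ
  agreement a w = ∑𝔽 n (λ y → ∑𝔽 m (λ b → agree a y b w))

  owAgree≡∑agreement : owAgree (Add m ⁺) M h ≡ ∑𝔽 m (λ a → ∑𝔽 n (agreement a))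
  owAgree≡∑agreement = begin
    owAgree (Add m ⁺) M h
      ≡⟨ ∑𝔽-++ m n _ ⟩
    ∑𝔽 m (λ a → ∑𝔽 n (λ y → ∑𝔽 (m + n) (λ v → F (a ++ y) v)))
      ≡⟨ ∑-cong (allVecs m) (λ a → ∑-cong (allVecs n) (λ y → ∑𝔽-++ m n _)) ⟩
    ∑𝔽 m (λ a → ∑𝔽 n (λ y → ∑𝔽 m (λ b → ∑𝔽 n (λ w → F (a ++ y) (b ++ w)))))
      ≡⟨ ∑-cong (allVecs m) (λ a → ∑-cong (allVecs n) (λ y →
           ∑-cong (allVecs m) (λ b → ∑-cong (allVecs n) (λ w → F-++ a y b w)))) ⟩
    ∑𝔽 m (λ a → ∑𝔽 n (λ y → ∑𝔽 m (λ b → ∑𝔽 n (λ w → agree a y b w))))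
      ≡⟨ ∑-cong (allVecs m) (λ a → ∑-cong (allVecs n) (λ y → ∑-swap (allVecs m) (allVecs n) (agree a y))) ⟩
    ∑𝔽 m (λ a → ∑𝔽 n (λ y → ∑𝔽 n (λ w → ∑𝔽 m (λ b → agree a y b w))))
      ≡⟨ ∑-cong (allVecs m) (λ a → ∑-swap (allVecs n) (allVecs n) _) ⟩
    ∑𝔽 m (λ a → ∑𝔽 n (agreement a))
      ∎
    where
    open ≡-Reasoning
    F : 𝔽₂^ (m + n) → 𝔽₂^ (m + n) → ℕ
    F u v = indicator (h (M u) v) (Add m (u ⊕ v))
    F-++ : ∀ a y b w → F (a ++ y) (b ++ w) ≡ agree a y b w
    F-++ a y b w = cong (indicator (h (M (a ++ y)) (b ++ w)))
                        (trans (cong (Add m) (⊕-++ a b y w)) (Add-++ m (a ⊕ b) (y ⊕ w)))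

  agreement+2^n≤ : ∀ a w → agreement a w + 2 ^ n ≤ 2 ^ n * n + 2 ^ t
  agreement+2^n≤ a w = one-way-index-bound (λ y → M (a ++ y)) (λ s b → h s (b ++ w)) (_⊕ w) (toIndex ∘ (a ⊕_))
    (⊕-injectiveʳ w) address-surjective
    where
    address-surjective : ∀ i → ∃ λ b → toIndex (a ⊕ b) ≡ i
    address-surjective i with toIndex-surjective {m} i
    ... | x , refl = a ⊕ x , cong toIndex (⊕-cancelˡ a x)

  owAgree+≤ : owAgree (Add m ⁺) M h + n * (2 ^ n * 2 ^ n) ≤ n * (2 ^ n * (2 ^ n * n + 2 ^ t))
  owAgree+≤ = subst (λ A → A + n * (2 ^ n * 2 ^ n) ≤ n * (2 ^ n * (2 ^ n * n + 2 ^ t)))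
    (sym owAgree≡∑agreement) (∑𝔽-bound m (λ a → ∑𝔽-bound n (agreement+2^n≤ a)))

one-way-arithmetic : ∀ {O n X τ d} .{{_ : NonZero n}} .{{_ : NonZero X}} →
                     O + n * (X * X) ≤ n * (X * (X * n + τ)) → 2 * τ ≤ X → 1 ≤ d → d ≤ n →
                     2 * (n * n) * O + 1 * (n ∸ d) * ((n * X) * (n * X)) < 2 * (n * n) * ((n * X) * (n * X))
one-way-arithmetic {O} {n} {X} {τ} {d} O≤ 2τ≤X 1≤d d≤n = begin-strict
  c * O + 1 * (n ∸ d) * Z ≡⟨ cong (λ a → c * O + a * Z) (*-identityˡ (n ∸ d)) ⟩
  c * O + (n ∸ d) * Z     <⟨ +-monoʳ-< (c * O) (*-monoˡ-< Z (∸-monoʳ-< 1≤d d≤n)) ⟩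
  c * O + n * Z           ≤⟨ +-cancelʳ-≤ (n * Z) _ _ twice-excess ⟩
  c * Z                   ∎
  where
  open ≤-Reasoning
  c = 2 * (n * n)
  Z = (n * X) * (n * X)
  instance
    Z≢0 : NonZero Z
    Z≢0 = m*n≢0 (n * X) (n * X) {{m*n≢0 n X}} {{m*n≢0 n X}}
  collect : ∀ O n X → 2 * (n * n) * O + n * ((n * X) * (n * X)) + n * ((n * X) * (n * X))
                      ≡ 2 * (n * n) * (O + n * (X * X))
  collect = solve-∀
  expand : ∀ n X τ → 2 * (n * n) * (n * (X * (X * n + τ)))
                     ≡ 2 * (n * n) * ((n * X) * (n * X)) + n * n * n * X * (2 * τ)
  expand = solve-∀
  regroup : ∀ n X → n * n * n * X * X ≡ n * ((n * X) * (n * X))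
  regroup = solve-∀
  twice-excess : c * O + n * Z + n * Z ≤ c * Z + n * Z
  twice-excess = begin
    c * O + n * Z + n * Z           ≡⟨ collect O n X ⟩
    c * (O + n * (X * X))           ≤⟨ *-monoʳ-≤ c O≤ ⟩
    c * (n * (X * (X * n + τ)))     ≡⟨ expand n X τ ⟩
    c * Z + n * n * n * X * (2 * τ) ≤⟨ +-monoʳ-≤ (c * Z) (*-monoʳ-≤ (n * n * n * X) 2τ≤X) ⟩
    c * Z + n * n * n * X * X       ≡⟨ cong (c * Z +_) (regroup n X) ⟩
    c * Z + n * Z                   ∎

4^≡2^*2^ : ∀ N → 4 ^ N ≡ 2 ^ N * 2 ^ N
4^≡2^*2^ N = trans (^-*-assoc 2 2 N) (trans (cong (λ e → 2 ^ (N + e)) (+-identityʳ N)) (^-distribˡ-+-* 2 N N))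

one-way-lower-bound : ∀ m d → 1 ≤ d → d ≤ 2 ^ m → ∀ t → t < d →
  (M : 𝔽₂^ (m + 2 ^ m) → Vec Bool t) (h : Vec Bool t → 𝔽₂^ (m + 2 ^ m) → Bool) →
  2 * (2 ^ m * 2 ^ m) * owAgree (Add m ⁺) M h + 1 * (2 ^ m ∸ d) * (4 ^ (m + 2 ^ m))
    < 2 * (2 ^ m * 2 ^ m) * (4 ^ (m + 2 ^ m))
one-way-lower-bound m d 1≤d d≤n t t<d M h rewrite 4^≡2^*2^ (m + 2 ^ m) | 2^[m+2^m]≡ m =
  one-way-arithmetic {{m^n≢0 2 m}} {{m^n≢0 2 (2 ^ m)}}
    (OneWay.owAgree+≤ m M h) (^-monoʳ-≤ 2 (≤-trans t<d d≤n)) 1≤d d≤n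

theorem4p7 : Σ ℕ λ p → Σ ℕ λ q → 1 ≤ p × 1 ≤ q ×
  ((m d : ℕ) → 1 ≤ d → d ≤ 2 ^ m →
    ((k : ℕ) → k < d → (α : Vec (𝔽₂^ (m + 2 ^ m)) k) → (g : Vec Bool k → Bool) →
      ¬ (2 ^ (m + 2 ^ m) ≤ 2 * linAgree (Add m) α g
         × d * (2 ^ (m + 2 ^ m) * 2 ^ (m + 2 ^ m))
           ≤ 2 ^ m * ((2 * linAgree (Add m) α g ∸ 2 ^ (m + 2 ^ m))
                      * (2 * linAgree (Add m) α g ∸ 2 ^ (m + 2 ^ m)))))
    × ((t : ℕ) → t < d → (M : 𝔽₂^ (m + 2 ^ m) → Vec Bool t) →
       (h : Vec Bool t → 𝔽₂^ (m + 2 ^ m) → Bool) →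
      q * (2 ^ m * 2 ^ m) * owAgree (Add m ⁺) M h
        + p * (2 ^ m ∸ d) * (4 ^ (m + 2 ^ m))
        < q * (2 ^ m * 2 ^ m) * (4 ^ (m + 2 ^ m))))
theorem4p7 = 1 , 2 , ≤-refl , s≤s z≤n , λ m d 1≤d d≤n →
  (λ k k<d α g → linear-sketch-lower-bound m d d≤n k k<d α g ∘ proj₂) ,
  one-way-lower-bound m d 1≤d d≤n
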